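{- Let $(\mathcal{T}_r)_{r\in\mathbb{Z}}$ be a sequence of complex numbers satisfying $\mathcal{T}_r=\mathcal{T}_{r-1}+\mathcal{T}_{r-2}+\mathcal{T}_{r-3}$ for all integers $r$. Then for every non-negative integer $k$: \[ \begin{aligned} 8\sum_{j=0}^k j\,\mathcal{T}_j^2 &= (9k-2)\mathcal{T}_k^2 + 7(k-1)\mathcal{T}_{k-1}^2 + 4(k-2)\mathcal{T}_{k-2}^2 - 2k\mathcal{T}_{k-3}^2 - k\mathcal{T}_{k-4}^2 - (k-1)\mathcal{T}_{k-5}^2\\ &\quad + 11\mathcal{T}_{ -1}^2 + 14\mathcal{T}_{ -2}^2 + 12\mathcal{T}_{ -3}^2 - 2\mathcal{T}_{ -4}^2 - \mathcal{T}_{ -5}^2 - 2\mathcal{T}_{ -6}^2 . \end{aligned} \]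
   Context: A generalized Tribonacci sequence is determined by arbitrary initial values $\mathcal{T}_0,\mathcal{T}_1,\mathcal{T}_2$ and the recurrence $\mathcal{T}_r=\mathcal{T}_{r-1}+\mathcal{T}_{r-2}+\mathcal{T}_{r-3}$, extended to all integer indices. -}

module Defs where

open import Level using (_⊔_)
open import Algebra.Bundles using (CommutativeRing)
open import Data.Nat as ℕ using (ℕ; zero; suc)
open import Data.Integer as ℤ using (ℤ; +_; -[1+_])
open import Data.Integer using () renaming (_*_ to _*ℤ_; _-_ to _-ℤ_; -_ to -ℤ_)

module _ {c ℓ} (R : CommutativeRing c ℓ) where
  open CommutativeRing R hiding (zero)

  natCast : ℕ → Carrier
  natCast zero    = 0#
  natCast (suc n) = 1# + natCast n

  intCast : ℤ → Carrier
  intCast (+ n)      = natCast n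
  intCast -[1+ n ]   = - natCast (suc n)

  infixr 8 _·_
  _·_ : ℤ → Carrier → Carrier
  z · x = intCast z * x

  sq : Carrier → Carrier
  sq x = x * x

  sumTo : ℕ → (ℕ → Carrier) → Carrier
  sumTo zero    f = f zero
  sumTo (suc k) f = sumTo k f + f (suc k)

  IsTribonacci : (ℤ → Carrier) → Set ℓ
  IsTribonacci T = ∀ (r : ℤ) → T r ≈ T (r ℤ.- + 1) + T (r ℤ.- + 2) + T (r ℤ.- + 3)

  Identity13 : (ℤ → Carrier) → ℕ → Set ℓ
  Identity13 T k =
    (+ 8) · sumTo k (λ j → (+ j) · sq (T (+ j)))
    ≈ (+ 9 *ℤ K -ℤ + 2) · sq (T K)
      + (+ 7 *ℤ (K -ℤ + 1)) · sq (T (K -ℤ + 1))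
      + (+ 4 *ℤ (K -ℤ + 2)) · sq (T (K -ℤ + 2))
      - (+ 2 *ℤ K) · sq (T (K -ℤ + 3))
      - K · sq (T (K -ℤ + 4))
      - (K -ℤ + 1) · sq (T (K -ℤ + 5))
      + (+ 11) · sq (T (-ℤ + 1))
      + (+ 14) · sq (T (-ℤ + 2))
      + (+ 12) · sq (T (-ℤ + 3))
      - (+ 2) · sq (T (-ℤ + 4))
      - sq (T (-ℤ + 5))
      - (+ 2) · sq (T (-ℤ + 6))
    where K = + k

-- Write D(n) = T(n)² + T(n−4)² + T(n−6)² − 2T(n−1)² − 3T(n−2)² − 6T(n−3)². Since every
-- term of a Tribonacci sequence is a linear form in any three consecutive terms, D vanishes
-- identically. Call W(k) the part of the right-hand side that depends on k. Then
-- W(k) − W(k−1) − 8k T(k)² = (k−2) D(k), and W(0) + (the constant part) = −2 D(0), so both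
-- sides of the identity vanish at k = 0 and grow by 8k T(k)² from k − 1 to k.
module Submission where

open import Defs
open import Algebra.Bundles using (CommutativeRing)
open import Data.Nat using (ℕ)
open import Data.Integer using (ℤ)
open import Data.Nat as ℕ using (zero; suc)
open import Data.Integer as ℤ using (+_; -[1+_]; _⊖_)
import Data.Nat.Properties as ℕᵖ
import Data.Integer.Properties as ℤᵖ
open import Data.Integer.Tactic.RingSolver using (solve-∀)
open import Data.Maybe using (Maybe; just; nothing)
open import Relation.Nullary using (yes; no)
import Relation.Binary.PropositionalEquality as ≡
open import Relation.Binary.PropositionalEquality using (_≡_)
open import Algebra.Solver.Ring.AlmostCommutativeRing
  using (fromCommutativeRing; _-Raw-AlmostCommutative⟶_)
import Algebra.Solver.Ring as RingSolver
import Algebra.Properties.Ring as RingProperties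
import Algebra.Properties.Semiring.Mult as SemiringMultProperties
import Algebra.Properties.CommutativeSemigroup as CommutativeSemigroupProperties
import Relation.Binary.Reasoning.Setoid as SetoidReasoning

sub-sub : ∀ m i j → m ℤ.- i ℤ.- j ≡ m ℤ.- (j ℤ.+ i)
sub-sub = solve-∀

module IntegerCast {c ℓ} (R : CommutativeRing c ℓ) where

  open CommutativeRing R hiding (zero)
  open RingProperties ring using (-0#≈0#; -‿involutive; -‿+-comm; -‿distribˡ-*)
  open SemiringMultProperties semiring using (_×_; ×-homo-+)
  open CommutativeSemigroupProperties +-commutativeSemigroup using (interchange)
  open SetoidReasoning setoid

  ι : ℕ → Carrier
  ι = natCast R

  ι≈×1# : ∀ n → ι n ≈ n × 1#
  ι≈×1# zero    = refl
  ι≈×1# (suc n) = +-congˡ (ι≈×1# n)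

  ι-+ : ∀ m n → ι (m ℕ.+ n) ≈ ι m + ι n
  ι-+ m n = begin
    ι (m ℕ.+ n)      ≈⟨ ι≈×1# (m ℕ.+ n) ⟩
    (m ℕ.+ n) × 1#   ≈⟨ ×-homo-+ 1# m n ⟩
    m × 1# + n × 1#  ≈⟨ +-cong (ι≈×1# m) (ι≈×1# n) ⟨
    ι m + ι n        ∎

  [a+x]-[a+y]≈x-y : ∀ a x y → (a + x) - (a + y) ≈ x - y
  [a+x]-[a+y]≈x-y a x y = begin
    (a + x) - (a + y)      ≈⟨ +-congˡ (-‿+-comm a y) ⟨
    (a + x) + (- a + - y)  ≈⟨ interchange a x (- a) (- y) ⟩
    (a - a) + (x - y)      ≈⟨ +-congʳ (-‿inverseʳ a) ⟩
    0# + (x - y)           ≈⟨ +-identityˡ (x - y) ⟩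
    x - y                  ∎

  intCast-⊖ : ∀ m n → intCast R (m ⊖ n) ≈ ι m - ι n
  intCast-⊖ m zero = begin
    intCast R (m ⊖ 0)  ≡⟨ ≡.cong (intCast R) (ℤᵖ.⊖-≥ {m} ℕ.z≤n) ⟩
    ι m                ≈⟨ +-identityʳ (ι m) ⟨
    ι m + 0#           ≈⟨ +-congˡ -0#≈0# ⟨
    ι m - 0#           ∎
  intCast-⊖ zero (suc n) = begin
    intCast R (0 ⊖ suc n)  ≡⟨ ≡.cong (intCast R) (ℤᵖ.⊖-≤ {0} {suc n} ℕ.z≤n) ⟩
    - ι (suc n)            ≈⟨ +-identityˡ _ ⟨
    0# - ι (suc n)         ∎
  intCast-⊖ (suc m) (suc n) = begin
    intCast R (suc m ⊖ suc n)  ≡⟨ ≡.cong (intCast R) (ℤᵖ.[1+m]⊖[1+n]≡m⊖n m n) ⟩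
    intCast R (m ⊖ n)          ≈⟨ intCast-⊖ m n ⟩
    ι m - ι n                  ≈⟨ [a+x]-[a+y]≈x-y 1# (ι m) (ι n) ⟨
    ι (suc m) - ι (suc n)      ∎

  intCast-neg : ∀ i → intCast R (ℤ.- i) ≈ - intCast R i
  intCast-neg (+ zero)  = sym -0#≈0#
  intCast-neg (+ suc n) = refl
  intCast-neg -[1+ n ]  = sym (-‿involutive _)

  intCast-+ : ∀ i j → intCast R (i ℤ.+ j) ≈ intCast R i + intCast R j
  intCast-+ (+ m)    (+ n)    = ι-+ m n
  intCast-+ (+ m)    -[1+ n ] = intCast-⊖ m (suc n)
  intCast-+ -[1+ m ] (+ n)    = trans (intCast-⊖ n (suc m)) (+-comm _ _)
  intCast-+ -[1+ m ] -[1+ n ] = begin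
    - ι (suc (suc (m ℕ.+ n)))   ≡⟨ ≡.cong (λ k → - ι (suc k)) (≡.sym (ℕᵖ.+-suc m n)) ⟩
    - ι (suc m ℕ.+ suc n)       ≈⟨ -‿cong (ι-+ (suc m) (suc n)) ⟩
    - (ι (suc m) + ι (suc n))   ≈⟨ -‿+-comm _ _ ⟨
    - ι (suc m) + - ι (suc n)   ∎

  intCast-- : ∀ i j → intCast R (i ℤ.- j) ≈ intCast R i - intCast R j
  intCast-- i j = trans (intCast-+ i (ℤ.- j)) (+-congˡ (intCast-neg j))

  intCast-* : ∀ i j → intCast R (i ℤ.* j) ≈ intCast R i * intCast R j
  intCast-* (+ m) j = +m*j m
    where
    +m*j : ∀ m → intCast R (+ m ℤ.* j) ≈ ι m * intCast R j
    +m*j zero    = sym (zeroˡ _)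
    +m*j (suc m) = begin
      intCast R (+ suc m ℤ.* j)            ≡⟨ ≡.cong (intCast R) (ℤᵖ.suc-* (+ m) j) ⟩
      intCast R (j ℤ.+ + m ℤ.* j)          ≈⟨ intCast-+ j (+ m ℤ.* j) ⟩
      intCast R j + intCast R (+ m ℤ.* j)  ≈⟨ +-cong (sym (*-identityˡ _)) (+m*j m) ⟩
      1# * intCast R j + ι m * intCast R j ≈⟨ distribʳ _ _ _ ⟨
      ι (suc m) * intCast R j              ∎
  intCast-* -[1+ m ] j = begin
    intCast R (-[1+ m ] ℤ.* j)         ≡⟨ ≡.cong (intCast R) (≡.sym (ℤᵖ.neg-distribˡ-* (+ suc m) j)) ⟩
    intCast R (ℤ.- (+ suc m ℤ.* j))    ≈⟨ intCast-neg (+ suc m ℤ.* j) ⟩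
    - intCast R (+ suc m ℤ.* j)        ≈⟨ -‿cong (intCast-* (+ suc m) j) ⟩
    - (ι (suc m) * intCast R j)        ≈⟨ -‿distribˡ-* _ _ ⟩
    - ι (suc m) * intCast R j          ∎

  intCast-homomorphism : ℤ.+-*-rawRing -Raw-AlmostCommutative⟶ fromCommutativeRing R
  intCast-homomorphism = record
    { ⟦_⟧    = intCast R
    ; +-homo = intCast-+
    ; *-homo = intCast-*
    ; -‿homo = intCast-neg
    ; 0-homo = refl
    ; 1-homo = +-identityʳ 1#
    }

  intCast-≟ : ∀ i j → Maybe (intCast R i ≈ intCast R j)
  intCast-≟ i j with i ℤ.≟ j
  ... | yes ≡.refl = just refl
  ... | no _       = nothing

  open RingSolver ℤ.+-*-rawRing (fromCommutativeRing R) intCast-homomorphism intCast-≟ public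
    using (Polynomial; solve; _:=_; con; _:+_; _:-_; _:*_; :-_)

module SquareIdentities {c ℓ} (R : CommutativeRing c ℓ) where

  open CommutativeRing R
  open RingProperties ring using (x≈y⇒x∙y⁻¹≈ε)
  open IntegerCast R
  open SetoidReasoning setoid

  infix 10 _²
  _² : Carrier → Carrier
  x ² = sq R x

  ²-cong : ∀ {x y} → x ≈ y → x ² ≈ y ²
  ²-cong x≈y = *-cong x≈y x≈y

  ≈-modulo : ∀ q {x y u v} → u ≈ v → x ≈ y + q * (u - v) → x ≈ y
  ≈-modulo q {x} {y} {u} {v} u≈v x≈y+q[u-v] = begin
    x                ≈⟨ x≈y+q[u-v] ⟩
    y + q * (u - v)  ≈⟨ +-congˡ (*-congˡ (x≈y⇒x∙y⁻¹≈ε u≈v)) ⟩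
    y + q * 0#       ≈⟨ +-congˡ (zeroʳ q) ⟩
    y + 0#           ≈⟨ +-identityʳ y ⟩
    y                ∎

  square-identity : ∀ {p a b c d e f} →
    p ≈ a + b + c → a ≈ b + c + d → b ≈ c + d + e → c ≈ d + e + f →
    p ² + d ² + f ² ≈ ι 2 * a ² + ι 3 * b ² + ι 6 * c ²
  square-identity {p} {a} {b} {c} {d} {e} {f} p≈ a≈ b≈ c≈ = begin
    p ² + d ² + f ²                    ≈⟨ +-congʳ (+-congʳ (²-cong p≈P)) ⟩
    P ² + d ² + f ²                    ≈⟨ polynomial-identity d e f ⟩
    ι 2 * A ² + ι 3 * B ² + ι 6 * C ²  ≈⟨ +-cong (+-cong (*-congˡ (²-cong a≈A)) (*-congˡ (²-cong b≈B)))
                                                  (*-congˡ (²-cong c≈)) ⟨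
    ι 2 * a ² + ι 3 * b ² + ι 6 * c ²  ∎
    where
    C B A P : Carrier
    C = d + e + f
    B = C + d + e
    A = B + C + d
    P = A + B + C

    b≈B : b ≈ B
    b≈B = trans b≈ (+-congʳ (+-congʳ c≈))

    a≈A : a ≈ A
    a≈A = trans a≈ (+-congʳ (+-cong b≈B c≈))

    p≈P : p ≈ P
    p≈P = trans p≈ (+-cong (+-cong a≈A b≈B) c≈)

    polynomial-identity : ∀ d e f →
      let C = d + e + f; B = C + d + e; A = B + C + d; P = A + B + C in
      P ² + d ² + f ² ≈ ι 2 * A ² + ι 3 * B ² + ι 6 * C ²
    polynomial-identity = solve 3 (λ d e f →
      let C = d :+ e :+ f; B = C :+ d :+ e; A = B :+ C :+ d; P = A :+ B :+ C in
      P :* P :+ d :* d :+ f :* f := con (+ 2) :* (A :* A) :+ con (+ 3) :* (B :* B) :+ con (+ 6) :* (C :* C)) refl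

  weightedSquares : Carrier → (t₀ t₁ t₂ t₃ t₄ t₅ : Carrier) → Carrier
  weightedSquares x t₀ t₁ t₂ t₃ t₄ t₅ =
    (ι 9 * x - ι 2) * t₀ ² + ι 7 * (x - ι 1) * t₁ ² + ι 4 * (x - ι 2) * t₂ ²
    - ι 2 * x * t₃ ² - x * t₄ ² - (x - ι 1) * t₅ ²

  initialSquares : (u₁ u₂ u₃ u₄ u₅ u₆ : Carrier) → Carrier
  initialSquares u₁ u₂ u₃ u₄ u₅ u₆ =
    ι 11 * u₁ ² + ι 14 * u₂ ² + ι 12 * u₃ ² - ι 2 * u₄ ² - u₅ ² - ι 2 * u₆ ²

  private
    infix 10 _²ᴾ
    _²ᴾ : ∀ {n} → Polynomial n → Polynomial n
    t ²ᴾ = t :* t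

    weightedSquaresᴾ : ∀ {n} → (x t₀ t₁ t₂ t₃ t₄ t₅ : Polynomial n) → Polynomial n
    weightedSquaresᴾ x t₀ t₁ t₂ t₃ t₄ t₅ =
      (con (+ 9) :* x :- con (+ 2)) :* t₀ ²ᴾ :+ con (+ 7) :* (x :- con (+ 1)) :* t₁ ²ᴾ
      :+ con (+ 4) :* (x :- con (+ 2)) :* t₂ ²ᴾ :- con (+ 2) :* x :* t₃ ²ᴾ :- x :* t₄ ²ᴾ
      :- (x :- con (+ 1)) :* t₅ ²ᴾ

    squareDefectᴾ : ∀ {n} → (t₀ t₁ t₂ t₃ t₄ t₆ : Polynomial n) → Polynomial n
    squareDefectᴾ t₀ t₁ t₂ t₃ t₄ t₆ =
      (t₀ ²ᴾ :+ t₄ ²ᴾ :+ t₆ ²ᴾ) :- (con (+ 2) :* t₁ ²ᴾ :+ con (+ 3) :* t₂ ²ᴾ :+ con (+ 6) :* t₃ ²ᴾ)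

  weightedSquares-pred : ∀ {x y t₀ t₁ t₂ t₃ t₄ t₅ t₆} → y ≈ x - ι 1 →
    t₀ ² + t₄ ² + t₆ ² ≈ ι 2 * t₁ ² + ι 3 * t₂ ² + ι 6 * t₃ ² →
    weightedSquares x t₀ t₁ t₂ t₃ t₄ t₅ ≈ weightedSquares y t₁ t₂ t₃ t₄ t₅ t₆ + ι 8 * (x * t₀ ²)
  weightedSquares-pred {x} {y} {t₀} {t₁} {t₂} {t₃} {t₄} {t₅} {t₆} y≈x-1 square =
    -- the second multiplier is minus the slope in x of weightedSquares at t₁ … t₆
    ≈-modulo (x - ι 2) square (≈-modulo _ y≈x-1 (solve 9 (λ x y t₀ t₁ t₂ t₃ t₄ t₅ t₆ →
      weightedSquaresᴾ x t₀ t₁ t₂ t₃ t₄ t₅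
      := weightedSquaresᴾ y t₁ t₂ t₃ t₄ t₅ t₆ :+ con (+ 8) :* (x :* t₀ ²ᴾ)
         :+ (x :- con (+ 2)) :* squareDefectᴾ t₀ t₁ t₂ t₃ t₄ t₆
         :+ :- (con (+ 9) :* t₁ ²ᴾ :+ con (+ 7) :* t₂ ²ᴾ :+ con (+ 4) :* t₃ ²ᴾ
                :- con (+ 2) :* t₄ ²ᴾ :- t₅ ²ᴾ :- t₆ ²ᴾ) :* (y :- (x :- con (+ 1))))
      refl x y t₀ t₁ t₂ t₃ t₄ t₅ t₆))

  weightedSquares-zero : ∀ {t₀ t₁ t₂ t₃ t₄ t₅ t₆} →
    t₀ ² + t₄ ² + t₆ ² ≈ ι 2 * t₁ ² + ι 3 * t₂ ² + ι 6 * t₃ ² →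
    weightedSquares 0# t₀ t₁ t₂ t₃ t₄ t₅ + initialSquares t₁ t₂ t₃ t₄ t₅ t₆ ≈ 0#
  weightedSquares-zero {t₀} {t₁} {t₂} {t₃} {t₄} {t₅} {t₆} square =
    ≈-modulo (- ι 2) square (solve 7 (λ t₀ t₁ t₂ t₃ t₄ t₅ t₆ →
      weightedSquaresᴾ (con (+ 0)) t₀ t₁ t₂ t₃ t₄ t₅
      :+ (con (+ 11) :* t₁ ²ᴾ :+ con (+ 14) :* t₂ ²ᴾ :+ con (+ 12) :* t₃ ²ᴾ
          :- con (+ 2) :* t₄ ²ᴾ :- t₅ ²ᴾ :- con (+ 2) :* t₆ ²ᴾ)
      := con (+ 0) :+ :- con (+ 2) :* squareDefectᴾ t₀ t₁ t₂ t₃ t₄ t₆)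
      refl t₀ t₁ t₂ t₃ t₄ t₅ t₆)

  weightedSquares-cast : ∀ K t₀ t₁ t₂ t₃ t₄ t₅ →
    intCast R (+ 9 ℤ.* K ℤ.- + 2) * t₀ ² + intCast R (+ 7 ℤ.* (K ℤ.- + 1)) * t₁ ²
    + intCast R (+ 4 ℤ.* (K ℤ.- + 2)) * t₂ ² - intCast R (+ 2 ℤ.* K) * t₃ ²
    - intCast R K * t₄ ² - intCast R (K ℤ.- + 1) * t₅ ²
    ≈ weightedSquares (intCast R K) t₀ t₁ t₂ t₃ t₄ t₅
  weightedSquares-cast K t₀ t₁ t₂ t₃ t₄ t₅ =
    +-cong (+-cong (+-cong (+-cong (+-cong (*-congʳ 9K-2) (*-congʳ 7[K-1])) (*-congʳ 4[K-2]))
                           (-‿cong (*-congʳ 2K)))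
                   refl)
           (-‿cong (*-congʳ (intCast-- K (+ 1))))
    where
    9K-2 : intCast R (+ 9 ℤ.* K ℤ.- + 2) ≈ ι 9 * intCast R K - ι 2
    9K-2 = trans (intCast-- (+ 9 ℤ.* K) (+ 2)) (+-congʳ (intCast-* (+ 9) K))

    7[K-1] : intCast R (+ 7 ℤ.* (K ℤ.- + 1)) ≈ ι 7 * (intCast R K - ι 1)
    7[K-1] = trans (intCast-* (+ 7) (K ℤ.- + 1)) (*-congˡ (intCast-- K (+ 1)))

    4[K-2] : intCast R (+ 4 ℤ.* (K ℤ.- + 2)) ≈ ι 4 * (intCast R K - ι 2)
    4[K-2] = trans (intCast-* (+ 4) (K ℤ.- + 2)) (*-congˡ (intCast-- K (+ 2)))

    2K : intCast R (+ 2 ℤ.* K) ≈ ι 2 * intCast R K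
    2K = intCast-* (+ 2) K

  w+a+b+c-d-e-f≈w+[a+b+c-d-e-f] : ∀ w a b c d e f →
    w + a + b + c - d - e - f ≈ w + (a + b + c - d - e - f)
  w+a+b+c-d-e-f≈w+[a+b+c-d-e-f] = solve 7 (λ w a b c d e f →
    w :+ a :+ b :+ c :- d :- e :- f := w :+ (a :+ b :+ c :- d :- e :- f)) refl

module TribonacciSquares {c ℓ} (R : CommutativeRing c ℓ) (T : ℤ → CommutativeRing.Carrier R)
                         (tribonacci : IsTribonacci R T) where

  open CommutativeRing R hiding (zero)
  open IntegerCast R using (ι; intCast--)
  open SquareIdentities R
  open CommutativeSemigroupProperties +-commutativeSemigroup using (xy∙z≈xz∙y)
  open SetoidReasoning setoid

  recurrence-below : ∀ n i →
    T (n ℤ.- + i) ≈ T (n ℤ.- + (1 ℕ.+ i)) + T (n ℤ.- + (2 ℕ.+ i)) + T (n ℤ.- + (3 ℕ.+ i))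
  recurrence-below n i =
    trans (tribonacci (n ℤ.- + i)) (+-cong (+-cong (reindex 1) (reindex 2)) (reindex 3))
    where
    reindex : ∀ j → T (n ℤ.- + i ℤ.- + j) ≈ T (n ℤ.- + (j ℕ.+ i))
    reindex j = reflexive (≡.cong T (sub-sub n (+ i) (+ j)))

  square-recurrence : ∀ n →
    T n ² + T (n ℤ.- + 4) ² + T (n ℤ.- + 6) ²
    ≈ ι 2 * T (n ℤ.- + 1) ² + ι 3 * T (n ℤ.- + 2) ² + ι 6 * T (n ℤ.- + 3) ²
  square-recurrence n = square-identity
    (tribonacci n) (recurrence-below n 1) (recurrence-below n 2) (recurrence-below n 3)

  weightedSquaresAt : ℤ → Carrier
  weightedSquaresAt K = weightedSquares (intCast R K)
    (T K) (T (K ℤ.- + 1)) (T (K ℤ.- + 2)) (T (K ℤ.- + 3)) (T (K ℤ.- + 4)) (T (K ℤ.- + 5))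

  initialSquaresOfT : Carrier
  initialSquaresOfT = initialSquares
    (T (ℤ.- + 1)) (T (ℤ.- + 2)) (T (ℤ.- + 3)) (T (ℤ.- + 4)) (T (ℤ.- + 5)) (T (ℤ.- + 6))

  weightedSquaresAt-pred : ∀ K →
    weightedSquaresAt K ≈ weightedSquaresAt (K ℤ.- + 1) + ι 8 * (intCast R K * T K ²)
  weightedSquaresAt-pred K
    rewrite sub-sub K (+ 1) (+ 1) | sub-sub K (+ 1) (+ 2) | sub-sub K (+ 1) (+ 3)
          | sub-sub K (+ 1) (+ 4) | sub-sub K (+ 1) (+ 5)
    = weightedSquares-pred (intCast-- K (+ 1)) (square-recurrence K)

  weighted-sum-closed-form : ∀ k →
    ι 8 * sumTo R k (λ j → intCast R (+ j) * T (+ j) ²) ≈ weightedSquaresAt (+ k) + initialSquaresOfT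
  weighted-sum-closed-form zero = begin
    ι 8 * (0# * T (+ 0) ²)                      ≈⟨ *-congˡ (zeroˡ _) ⟩
    ι 8 * 0#                                    ≈⟨ zeroʳ _ ⟩
    0#                                          ≈⟨ weightedSquares-zero (square-recurrence (+ 0)) ⟨
    weightedSquaresAt (+ 0) + initialSquaresOfT ∎
  weighted-sum-closed-form (suc k) = begin
    ι 8 * (S + k+1·T²)                                ≈⟨ distribˡ (ι 8) S k+1·T² ⟩
    ι 8 * S + ι 8 * k+1·T²                            ≈⟨ +-congʳ (weighted-sum-closed-form k) ⟩
    weightedSquaresAt (+ k) + initialSquaresOfT + ι 8 * k+1·T²
                                                      ≈⟨ xy∙z≈xz∙y _ _ _ ⟩
    weightedSquaresAt (+ k) + ι 8 * k+1·T² + initialSquaresOfT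
                                                      ≈⟨ +-congʳ (weightedSquaresAt-pred (+ suc k)) ⟨
    weightedSquaresAt (+ suc k) + initialSquaresOfT   ∎
    where
    S k+1·T² : Carrier
    S = sumTo R k (λ j → intCast R (+ j) * T (+ j) ²)
    k+1·T² = intCast R (+ suc k) * T (+ suc k) ²

mainTheorem13 : ∀ {c ℓ} (R : CommutativeRing c ℓ) (T : ℤ → CommutativeRing.Carrier R) →
    IsTribonacci R T → (k : ℕ) → Identity13 R T k
mainTheorem13 R T tribonacci k =
  trans (weighted-sum-closed-form k)
        (sym (trans (w+a+b+c-d-e-f≈w+[a+b+c-d-e-f] _ _ _ _ _ _ _)
                    (+-congʳ (weightedSquares-cast (+ k) _ _ _ _ _ _))))
  where
  open CommutativeRing R using (trans; sym; +-congʳ)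
  open SquareIdentities R using (w+a+b+c-d-e-f≈w+[a+b+c-d-e-f]; weightedSquares-cast)
  open TribonacciSquares R T tribonacci using (weighted-sum-closed-form)
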